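{- Let $k<l$ be positive integers with $\gcd\{k,l\}=1$. Define the real sequence $(a_n)_{n\ge 0}$ by $$a_n=\begin{cases}\dfrac{1+(-1)^{\lfloor n/k\rfloor+1}}{2}, & 0\le n<l,\\[2mm] 1-\dfrac12\left(a_{n-k}+a_{n-l}\right), & n\ge l.\end{cases}$$ If $l\not\equiv k\pmod 2$, then $\lim_{n\to\infty}a_n=\frac12$.
   Context: $a_n$ is the probability that the next player to move wins the randomized one-pile subtraction game with subtraction set $\{k,l\}$ starting from a pile of $n$ chips. In this game, at each position $m$ an element of $\{s\in\{k,l\}: s\le m\}$ is chosen uniformly at random and that many chips are removed. The player facing a position with no legal move loses. -}

module Defs where

open import Data.Nat as ℕ using (ℕ; zero; suc; _∸_)
open import Data.Nat.DivMod using (_/_)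
open import Data.Rational using (ℚ; 0ℚ; 1ℚ; ½; -_; _+_; _*_; _-_)

negOnePow : ℕ → ℚ
negOnePow zero    = 1ℚ
negOnePow (suc m) = - negOnePow m

-- IsSeq k l a  says  a n = (1 + (-1)^(⌊n/k⌋+1))/2  for 0 ≤ n < l, and
-- a n = 1 - (a (n-k) + a (n-l))/2  for n ≥ l.
-- (These equations determine a uniquely when 0 < k < l.)
IsSeq : (k l : ℕ) → .{{_ : ℕ.NonZero k}} → (ℕ → ℚ) → Set
IsSeq k l a =
  (∀ n → n ℕ.< l → a n ≡ ½ * (1ℚ + negOnePow (suc (n / k)))) ×
  (∀ n → l ℕ.≤ n → a n ≡ 1ℚ - ½ * (a (n ∸ k) + a (n ∸ l)))
  where
  open import Relation.Binary.PropositionalEquality using (_≡_)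
  open import Data.Product using (_×_)

{-# OPTIONS --safe #-}
-- With b n = a n - ½ the recurrence reads b n = -(b (n-k) + b (n-l))/2, and |b n| ≤ ½.
-- Suppose |b j| ≤ M from some index on. The recurrence gives M - b n ≥ ½ (M + b (n-k)), and the
-- same holds for -b; iterating this l times in steps of k gives ½^l (M - (-1)^l b (n-kl)) ≤ M - b n,
-- and k times in steps of l gives ½^k (M - (-1)^k b (n-kl)) ≤ M - b n. Since k and l have opposite
-- parity, adding the two cancels b (n-kl) and leaves ½^l M ≤ M - b n; with -b as well,
-- |b n| ≤ M - ½^l M after a delay of l + lk. So while M ≥ ε the bound drops by ½^l ε per delay,
-- and by the Archimedean property it falls below ε after finitely many delays.
module Submission where

open import Defs
open import Data.Nat as ℕ using (ℕ; NonZero)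
open import Data.Nat.GCD using (gcd)
open import Data.Nat.DivMod using (_%_)
open import Data.Rational using (ℚ; ½; _-_; ∣_∣; _<_; 0ℚ)
open import Data.Product using (∃)
open import Relation.Binary.PropositionalEquality using (_≡_; _≢_)

open import Algebra.Bundles using (CommutativeRing)
open import Data.Empty using (⊥-elim)
open import Data.Integer as ℤ using (+_; +[1+_]; -[1+_])
import Data.Integer.Properties as ℤ
open import Data.Nat using (zero; suc; _∸_; _≤′_; ≤′-refl; ≤′-step)
import Data.Nat.Properties as ℕ
open import Data.Nat.Induction using (<-rec)
open import Data.Product using (_,_)
open import Data.Rational
  using ( mkℚ; 1ℚ; -_; _+_; _*_; _/_; 1/_; _≤_; *≤*; *<*; _<?_
        ; Positive; NonNegative; positive; nonNegative; +-*-rawSemiring)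
open import Data.Rational.Literals using (fromℤ)
open import Data.Rational.Properties
open import Data.Rational.Solver using (module +-*-Solver)
open import Data.Sum using (inj₁; inj₂)
open import Relation.Binary.PropositionalEquality
  using (refl; sym; trans; cong; subst; subst₂; module ≡-Reasoning)
open import Relation.Nullary using (yes; no)

open import Algebra.Definitions.RawSemiring +-*-rawSemiring using (_×_; _^_)
open import Algebra.Properties.Semiring.Mult (CommutativeRing.semiring +-*-commutativeRing) using (×-assoc-*)
open import Algebra.Properties.Group +-0-group using () renaming (⁻¹-involutive to neg-involutive)
open +-*-Solver

p≤∣p∣ : ∀ p → p ≤ ∣ p ∣
p≤∣p∣ (mkℚ (+ _) _ _)    = ≤-refl
p≤∣p∣ (mkℚ -[1+ _ ] _ _) = *≤* ℤ.-≤+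

-p≤∣p∣ : ∀ p → - p ≤ ∣ p ∣
-p≤∣p∣ p = subst (- p ≤_) (∣-p∣≡∣p∣ p) (p≤∣p∣ (- p))

p≤q∧-p≤q⇒∣p∣≤q : ∀ {p q} → p ≤ q → - p ≤ q → ∣ p ∣ ≤ q
p≤q∧-p≤q⇒∣p∣≤q {p} {q} p≤q -p≤q with ∣p∣≡p∨∣p∣≡-p p
... | inj₁ ∣p∣≡p  = subst (_≤ q) (sym ∣p∣≡p) p≤q
... | inj₂ ∣p∣≡-p = subst (_≤ q) (sym ∣p∣≡-p) -p≤q

p≤p+q : ∀ {p q} → 0ℚ ≤ q → p ≤ p + q
p≤p+q {p} {q} 0≤q = subst (_≤ p + q) (+-identityʳ p) (+-monoʳ-≤ p 0≤q)

p≤q⇒0≤q-p : ∀ {p q} → p ≤ q → 0ℚ ≤ q - p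
p≤q⇒0≤q-p {p} {q} p≤q = subst (_≤ q - p) (+-inverseʳ p) (+-monoˡ-≤ (- p) p≤q)

0≤q-p⇒p≤q : ∀ {p q} → 0ℚ ≤ q - p → p ≤ q
0≤q-p⇒p≤q {p} {q} 0≤q-p =
  subst₂ _≤_ (+-identityˡ p) (solve 2 (λ p q → q :- p :+ p := q) refl p q) (+-monoˡ-≤ p 0≤q-p)

r≤q-p⇒p≤q-r : ∀ {p q r} → r ≤ q - p → p ≤ q - r
r≤q-p⇒p≤q-r {p} {q} {r} r≤q-p =
  0≤q-p⇒p≤q (subst (0ℚ ≤_) (solve 3 (λ p q r → q :- p :- r := q :- r :- p) refl p q r)
                           (p≤q⇒0≤q-p r≤q-p))

∣p∣≤q⇒0≤q-p : ∀ {p q} → ∣ p ∣ ≤ q → 0ℚ ≤ q - p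
∣p∣≤q⇒0≤q-p {p} ∣p∣≤q = p≤q⇒0≤q-p (≤-trans (p≤∣p∣ p) ∣p∣≤q)

∣p∣≤q⇒0≤q+p : ∀ {p q} → ∣ p ∣ ≤ q → 0ℚ ≤ q + p
∣p∣≤q⇒0≤q+p {p} {q} ∣p∣≤q =
  subst (λ x → 0ℚ ≤ q + x) (neg-involutive p) (p≤q⇒0≤q-p (≤-trans (-p≤∣p∣ p) ∣p∣≤q))

0≤½*p : ∀ {p} → 0ℚ ≤ p → 0ℚ ≤ ½ * p
0≤½*p = *-monoˡ-≤-nonNeg ½

½*p≤p : ∀ {p} → 0ℚ ≤ p → ½ * p ≤ p
½*p≤p {p} 0≤p =
  subst (½ * p ≤_) (solve 1 (λ p → con ½ :* p :+ con ½ :* p := p) refl p) (p≤p+q (0≤½*p 0≤p))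

½^-positive : ∀ i → Positive (½ ^ i)
½^-positive zero    = _
½^-positive (suc i) = pos*pos⇒pos ½ (½ ^ i) {{½^-positive i}}

½^-nonNegative : ∀ i → NonNegative (½ ^ i)
½^-nonNegative i = pos⇒nonNeg (½ ^ i) {{½^-positive i}}

½^-antitone : ∀ {i j} → i ℕ.≤ j → ½ ^ j ≤ ½ ^ i
½^-antitone i≤j = antitone′ (ℕ.≤⇒≤′ i≤j)
  where
  antitone′ : ∀ {i j} → i ≤′ j → ½ ^ j ≤ ½ ^ i
  antitone′ ≤′-refl               = ≤-refl
  antitone′ {j = suc j} (≤′-step i≤′j) =
    ≤-trans (½*p≤p (nonNegative⁻¹ (½ ^ j) {{½^-nonNegative j}})) (antitone′ i≤′j)

negOnePow-opposite : ∀ m n → m % 2 ≢ n % 2 → negOnePow m ≡ - negOnePow n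
negOnePow-opposite (suc (suc m)) n ne = trans (neg-involutive (negOnePow m)) (negOnePow-opposite m n ne)
negOnePow-opposite m (suc (suc n)) ne =
  trans (negOnePow-opposite m n ne) (cong -_ (sym (neg-involutive (negOnePow n))))
negOnePow-opposite 0 0 ne = ⊥-elim (ne refl)
negOnePow-opposite 0 1 _  = refl
negOnePow-opposite 1 0 _  = refl
negOnePow-opposite 1 1 ne = ⊥-elim (ne refl)

∣negOnePow∣≡1 : ∀ m → ∣ negOnePow m ∣ ≡ 1ℚ
∣negOnePow∣≡1 zero    = refl
∣negOnePow∣≡1 (suc m) = trans (∣-p∣≡∣p∣ (negOnePow m)) (∣negOnePow∣≡1 m)

∣negOnePow*p∣≡∣p∣ : ∀ m p → ∣ negOnePow m * p ∣ ≡ ∣ p ∣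
∣negOnePow*p∣≡∣p∣ m p = begin
  ∣ negOnePow m * p ∣        ≡⟨ ∣p*q∣≡∣p∣*∣q∣ (negOnePow m) p ⟩
  ∣ negOnePow m ∣ * ∣ p ∣    ≡⟨ cong (_* ∣ p ∣) (∣negOnePow∣≡1 m) ⟩
  1ℚ * ∣ p ∣                 ≡⟨ *-identityˡ ∣ p ∣ ⟩
  ∣ p ∣                      ∎
  where open ≡-Reasoning

×1≡fromℤ : ∀ n → n × 1ℚ ≡ fromℤ (+ n)
×1≡fromℤ zero    = refl
×1≡fromℤ (suc n) = begin
  1ℚ + n × 1ℚ                         ≡⟨ cong (λ x → 1ℚ + x) (×1≡fromℤ n) ⟩
  (+ 1 ℤ.* + 1 ℤ.+ + n ℤ.* + 1) / 1  ≡⟨ cong (_/ 1) 1+n≡suc-n ⟩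
  + suc n / 1                         ≡⟨ ↥p/↧p≡p (fromℤ (+ suc n)) ⟩
  fromℤ (+ suc n)                     ∎
  where
  open ≡-Reasoning
  1+n≡suc-n : + 1 ℤ.* + 1 ℤ.+ + n ℤ.* + 1 ≡ + suc n
  1+n≡suc-n = cong (λ x → + 1 ℤ.+ x) (ℤ.*-identityʳ (+ n))

archimedean : ∀ η → 0ℚ < η → ∃ λ t → 1ℚ ≤ t × η
archimedean (mkℚ (+ 0) _ _)    (*<* (ℤ.+<+ ()))
archimedean (mkℚ -[1+ _ ] _ _) (*<* ())
archimedean η@(mkℚ +[1+ a ] d _) _ = suc d , (begin
    1ℚ                  ≡⟨ *-inverseʳ D ⟨
    D * 1/ D            ≤⟨ *-monoˡ-≤-nonNeg D 1/D≤η ⟩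
    D * η               ≡⟨ cong (_* η) (×1≡fromℤ (suc d)) ⟨
    (suc d × 1ℚ) * η    ≡⟨ ×-assoc-* (suc d) 1ℚ η ⟩
    suc d × (1ℚ * η)    ≡⟨ cong (suc d ×_) (*-identityˡ η) ⟩
    suc d × η           ∎)
  where
  open ≤-Reasoning
  D : ℚ
  D = fromℤ (+ suc d)
  1/D≤η : 1/ D ≤ η
  1/D≤η = *≤* (ℤ.+≤+ (ℕ.*-monoˡ-≤ (suc d) (ℕ.s≤s (ℕ.z≤n {a}))))

Recurrence : ℕ → ℕ → (ℕ → ℚ) → Set
Recurrence d d′ c = ∀ m → d ℕ.≤ m → d′ ℕ.≤ m → c m ≡ - (½ * (c (m ∸ d) + c (m ∸ d′)))

BoundedFrom : ℕ → ℚ → (ℕ → ℚ) → Set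
BoundedFrom s M c = ∀ j → s ℕ.≤ j → ∣ c j ∣ ≤ M

EventuallyBelow : ℚ → (ℕ → ℚ) → Set
EventuallyBelow ε c = ∃ λ N → ∀ n → N ℕ.≤ n → ∣ c n ∣ < ε

TendsToZero : (ℕ → ℚ) → Set
TendsToZero c = ∀ ε → 0ℚ < ε → EventuallyBelow ε c

negate : (ℕ → ℚ) → ℕ → ℚ
negate c j = - c j

module _ {d d′ : ℕ} {c : ℕ → ℚ} where

  Recurrence-swap : Recurrence d d′ c → Recurrence d′ d c
  Recurrence-swap rec m d′≤m d≤m =
    trans (rec m d≤m d′≤m) (cong (λ x → - (½ * x)) (+-comm (c (m ∸ d)) (c (m ∸ d′))))

  Recurrence-negate : Recurrence d d′ c → Recurrence d d′ (negate c)
  Recurrence-negate rec m d≤m d′≤m = trans (cong -_ (rec m d≤m d′≤m))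
    (solve 2 (λ x y → :- (:- (con ½ :* (x :+ y))) := :- (con ½ :* (:- x :+ :- y)))
           refl (c (m ∸ d)) (c (m ∸ d′)))

BoundedFrom-negate : ∀ {s M c} → BoundedFrom s M c → BoundedFrom s M (negate c)
BoundedFrom-negate {c = c} bounded j s≤j = subst (_≤ _) (sym (∣-p∣≡∣p∣ (c j))) (bounded j s≤j)

bounded-everywhere : ∀ {d d′ M c} .{{_ : NonZero d}} → d ℕ.≤ d′ → Recurrence d d′ c →
                     (∀ j → j ℕ.< d′ → ∣ c j ∣ ≤ M) → BoundedFrom 0 M c
bounded-everywhere {d} {d′} {M} {c} d≤d′ rec initial j _ = <-rec (λ j → ∣ c j ∣ ≤ M) step j
  where
  step : ∀ j → (∀ {i} → i ℕ.< j → ∣ c i ∣ ≤ M) → ∣ c j ∣ ≤ M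
  step j below with j ℕ.<? d′
  ... | yes j<d′ = initial j j<d′
  ... | no j≮d′  = begin
    ∣ c j ∣                              ≡⟨ cong ∣_∣ (rec j d≤j d′≤j) ⟩
    ∣ - (½ * (x + y)) ∣                  ≡⟨ ∣-p∣≡∣p∣ (½ * (x + y)) ⟩
    ∣ ½ * (x + y) ∣                      ≡⟨ ∣p*q∣≡∣p∣*∣q∣ ½ (x + y) ⟩
    ½ * ∣ x + y ∣                        ≤⟨ *-monoˡ-≤-nonNeg ½ (∣p+q∣≤∣p∣+∣q∣ x y) ⟩
    ½ * (∣ x ∣ + ∣ y ∣)                  ≤⟨ *-monoˡ-≤-nonNeg ½ (+-mono-≤ (below j∸d<j) (below j∸d′<j)) ⟩
    ½ * (M + M)                          ≡⟨ solve 1 (λ M → con ½ :* (M :+ M) := M) refl M ⟩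
    M                                    ∎
    where
    open ≤-Reasoning
    x y : ℚ
    x = c (j ∸ d)
    y = c (j ∸ d′)
    d′≤j : d′ ℕ.≤ j
    d′≤j = ℕ.≮⇒≥ j≮d′
    d≤j : d ℕ.≤ j
    d≤j = ℕ.≤-trans d≤d′ d′≤j
    0<d : 0 ℕ.< d
    0<d = ℕ.>-nonZero⁻¹ d
    j∸d<j : j ∸ d ℕ.< j
    j∸d<j = ℕ.∸-monoʳ-< 0<d d≤j
    j∸d′<j : j ∸ d′ ℕ.< j
    j∸d′<j = ℕ.∸-monoʳ-< (ℕ.<-≤-trans 0<d d≤d′) d′≤j

module _ {c : ℕ → ℚ} {ε η : ℚ}
         (improve : ∀ {s M} → BoundedFrom s M c → ε ≤ M → ∃ λ s′ → BoundedFrom s′ (M - η) c) where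

  eventually-below : ∀ t {s M} → BoundedFrom s M c → M < ε + t × η → EventuallyBelow ε c
  eventually-below t {s} {M} bounded M<ε+tη with M <? ε
  eventually-below t {s} bounded _ | yes M<ε = s , λ n s≤n → ≤-<-trans (bounded n s≤n) M<ε
  eventually-below zero {M = M} _ M<ε+0 | no M≮ε = ⊥-elim (M≮ε (subst (M <_) (+-identityʳ ε) M<ε+0))
  eventually-below (suc t) {M = M} bounded M<ε+η+tη | no M≮ε =
    let s′ , bounded′ = improve bounded (≮⇒≥ M≮ε) in eventually-below t bounded′ M-η<ε+tη
    where
    M-η<ε+tη : M - η < ε + t × η
    M-η<ε+tη = subst (M - η <_) (solve 3 (λ ε η x → ε :+ (η :+ x) :- η := ε :+ x) refl ε η (t × η))
                     (+-monoˡ-< (- η) {M} {ε + (η + t × η)} M<ε+η+tη)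

module _ {d d′ s : ℕ} {M : ℚ} where

  gap-step : ∀ {n} c → Recurrence d d′ c → BoundedFrom s M c → d ℕ.≤ n → s ℕ.+ d′ ℕ.≤ n →
             ½ * (M + c (n ∸ d)) ≤ M - c n
  gap-step {n} c rec bounded d≤n s+d′≤n = begin
    ½ * (M + x)                  ≤⟨ p≤p+q (0≤½*p 0≤M+y) ⟩
    ½ * (M + x) + ½ * (M + y)    ≡⟨ solve 3 (λ M x y → con ½ :* (M :+ x) :+ con ½ :* (M :+ y)
                                                       := M :- :- (con ½ :* (x :+ y))) refl M x y ⟩
    M - - (½ * (x + y))          ≡⟨ cong (λ x → M - x) (rec n d≤n d′≤n) ⟨
    M - c n                      ∎
    where
    open ≤-Reasoning
    x y : ℚ
    x = c (n ∸ d)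
    y = c (n ∸ d′)
    d′≤n : d′ ℕ.≤ n
    d′≤n = ℕ.≤-trans (ℕ.m≤n+m d′ s) s+d′≤n
    0≤M+y : 0ℚ ≤ M + y
    0≤M+y = ∣p∣≤q⇒0≤q+p (bounded (n ∸ d′) (ℕ.m+n≤o⇒m≤o∸n s s+d′≤n))

  gap-chain : ∀ i {n} c → Recurrence d d′ c → BoundedFrom s M c → s ℕ.+ d′ ℕ.+ i ℕ.* d ℕ.≤ n →
              ½ ^ i * (M - negOnePow i * c (n ∸ i ℕ.* d)) ≤ M - c n
  gap-chain zero {n} c _ _ _ =
    ≤-reflexive (solve 2 (λ M x → con 1ℚ :* (M :- con 1ℚ :* x) := M :- x) refl M (c n))
  gap-chain (suc i) {n} c rec bounded s+d′+d+id≤n = begin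
    ½ ^ suc i * (M - negOnePow (suc i) * c (n ∸ (d ℕ.+ i ℕ.* d)))
      ≡⟨ cong (λ m → ½ ^ suc i * (M - negOnePow (suc i) * c m)) (ℕ.∸-+-assoc n d (i ℕ.* d)) ⟨
    ½ * ½ ^ i * (M - - σ * z)
      ≡⟨ solve 4 (λ h σ z M → con ½ :* h :* (M :- (:- σ) :* z) := con ½ :* (h :* (M :- σ :* (:- z))))
                 refl (½ ^ i) σ z M ⟩
    ½ * (½ ^ i * (M - σ * negate c (n ∸ d ∸ i ℕ.* d)))
      ≤⟨ *-monoˡ-≤-nonNeg ½ chain-for-negation ⟩
    ½ * (M - - c (n ∸ d))
      ≡⟨ cong (λ x → ½ * (M + x)) (neg-involutive (c (n ∸ d))) ⟩
    ½ * (M + c (n ∸ d))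
      ≤⟨ gap-step c rec bounded d≤n (ℕ.≤-trans (ℕ.m≤m+n (s ℕ.+ d′) _) s+d′+d+id≤n) ⟩
    M - c n
      ∎
    where
    open ≤-Reasoning
    σ z : ℚ
    σ = negOnePow i
    z = c (n ∸ d ∸ i ℕ.* d)
    d≤n : d ℕ.≤ n
    d≤n = ℕ.≤-trans (ℕ.≤-trans (ℕ.m≤m+n d (i ℕ.* d)) (ℕ.m≤n+m _ (s ℕ.+ d′))) s+d′+d+id≤n
    s+d′+id≤n∸d : s ℕ.+ d′ ℕ.+ i ℕ.* d ℕ.≤ n ∸ d
    s+d′+id≤n∸d = ℕ.m+n≤o⇒m≤o∸n (s ℕ.+ d′ ℕ.+ i ℕ.* d)
      (subst (ℕ._≤ n) (trans (cong (s ℕ.+ d′ ℕ.+_) (ℕ.+-comm d (i ℕ.* d)))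
                             (sym (ℕ.+-assoc (s ℕ.+ d′) (i ℕ.* d) d))) s+d′+d+id≤n)
    chain-for-negation : ½ ^ i * (M - σ * negate c (n ∸ d ∸ i ℕ.* d)) ≤ M - negate c (n ∸ d)
    chain-for-negation =
      gap-chain i (negate c) (Recurrence-negate rec) (BoundedFrom-negate bounded) s+d′+id≤n∸d

module _ {k l : ℕ} (k≤l : k ℕ.≤ l) (opposite : negOnePow l ≡ - negOnePow k) where

  contraction : ∀ {s M n} c → Recurrence k l c → BoundedFrom s M c → s ℕ.+ l ℕ.+ l ℕ.* k ℕ.≤ n →
                ½ ^ l * M ≤ M - c n
  contraction {s} {M} {n} c rec bounded s+l+lk≤n = begin
    ½ ^ l * M
      ≡⟨ solve 4 (λ h σ z M → h :* M := con ½ :* (h :* (M :- (:- σ) :* z) :+ h :* (M :- σ :* z)))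
                 refl (½ ^ l) σ z M ⟩
    ½ * (½ ^ l * (M - - σ * z) + ½ ^ l * (M - σ * z))
      ≡⟨ cong (λ τ → ½ * (½ ^ l * (M - τ * z) + ½ ^ l * (M - σ * z))) opposite ⟨
    ½ * (½ ^ l * (M - negOnePow l * z) + ½ ^ l * (M - σ * z))
      ≤⟨ *-monoˡ-≤-nonNeg ½ (+-mono-≤ chain-of-k-steps (≤-trans shrink chain-of-l-steps)) ⟩
    ½ * ((M - c n) + (M - c n))
      ≡⟨ solve 1 (λ u → con ½ :* (u :+ u) := u) refl (M - c n) ⟩
    M - c n
      ∎
    where
    open ≤-Reasoning
    σ z : ℚ
    σ = negOnePow k
    z = c (n ∸ k ℕ.* l)
    chain-of-k-steps : ½ ^ l * (M - negOnePow l * z) ≤ M - c n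
    chain-of-k-steps = subst (λ m → ½ ^ l * (M - negOnePow l * c (n ∸ m)) ≤ M - c n) (ℕ.*-comm l k)
                             (gap-chain l c rec bounded s+l+lk≤n)
    chain-of-l-steps : ½ ^ k * (M - σ * z) ≤ M - c n
    chain-of-l-steps = gap-chain k c (Recurrence-swap rec) bounded
      (ℕ.≤-trans (ℕ.+-mono-≤ (ℕ.+-monoʳ-≤ s k≤l) (ℕ.≤-reflexive (ℕ.*-comm k l))) s+l+lk≤n)
    shrink : ½ ^ l * (M - σ * z) ≤ ½ ^ k * (M - σ * z)
    shrink = *-monoʳ-≤-nonNeg (M - σ * z) {{nonNegative 0≤M-σz}} (½^-antitone k≤l)
      where
      s≤n∸kl : s ℕ.≤ n ∸ k ℕ.* l
      s≤n∸kl = ℕ.m+n≤o⇒m≤o∸n s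
        (ℕ.≤-trans (ℕ.+-mono-≤ (ℕ.m≤m+n s l) (ℕ.≤-reflexive (ℕ.*-comm k l))) s+l+lk≤n)
      0≤M-σz : 0ℚ ≤ M - σ * z
      0≤M-σz =
        ∣p∣≤q⇒0≤q-p (subst (_≤ M) (sym (∣negOnePow*p∣≡∣p∣ k z)) (bounded (n ∸ k ℕ.* l) s≤n∸kl))

  decay : ∀ {s M ε} c → Recurrence k l c → BoundedFrom s M c → ε ≤ M →
          BoundedFrom (s ℕ.+ l ℕ.+ l ℕ.* k) (M - ½ ^ l * ε) c
  decay {s} {M} {ε} c rec bounded ε≤M n s+l+lk≤n =
    p≤q∧-p≤q⇒∣p∣≤q (upper c rec bounded)
                   (upper (negate c) (Recurrence-negate rec) (BoundedFrom-negate bounded))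
    where
    upper : ∀ c → Recurrence k l c → BoundedFrom s M c → c n ≤ M - ½ ^ l * ε
    upper c rec bounded = r≤q-p⇒p≤q-r {q = M}
      (≤-trans (*-monoˡ-≤-nonNeg (½ ^ l) {{½^-nonNegative l}} ε≤M) (contraction c rec bounded s+l+lk≤n))

  tendsToZero : ∀ {s c} → Recurrence k l c → BoundedFrom s 1ℚ c → TendsToZero c
  tendsToZero {c = c} rec bounded ε 0<ε =
    let t , 1≤tη = archimedean η 0<η in
    eventually-below (λ bounded′ ε≤M → _ , decay c rec bounded′ ε≤M) t bounded
                     (≤-<-trans 1≤tη (tη<ε+tη t))
    where
    η : ℚ
    η = ½ ^ l * ε
    0<η : 0ℚ < η
    0<η = positive⁻¹ η {{pos*pos⇒pos (½ ^ l) {{½^-positive l}} ε {{positive 0<ε}}}}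
    tη<ε+tη : ∀ t → t × η < ε + t × η
    tη<ε+tη t = subst (_< ε + t × η) (+-identityˡ (t × η)) (+-monoˡ-< (t × η) 0<ε)

mainTheorem2 : (k l : ℕ) → .{{_ : NonZero k}} → k ℕ.< l → gcd k l ≡ 1 →
    (a : ℕ → ℚ) → IsSeq k l a →
    l % 2 ≢ k % 2 →
    ∀ (ε : ℚ) → 0ℚ < ε → ∃ λ N → ∀ n → N ℕ.≤ n → ∣ a n - ½ ∣ < ε
mainTheorem2 k l k<l _ a (initial , recurrence) opposite-parity =
  tendsToZero k≤l (negOnePow-opposite l k opposite-parity) centred-recurrence
              (bounded-everywhere k≤l centred-recurrence centred-initial)
  where
  open ≡-Reasoning
  k≤l : k ℕ.≤ l
  k≤l = ℕ.<⇒≤ k<l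
  b : ℕ → ℚ
  b n = a n - ½
  centred-recurrence : Recurrence k l b
  centred-recurrence m _ l≤m = begin
    a m - ½                           ≡⟨ cong (_- ½) (recurrence m l≤m) ⟩
    1ℚ - ½ * (x + y) - ½              ≡⟨ solve 2 (λ x y → con 1ℚ :- con ½ :* (x :+ y) :- con ½
                                                      := :- (con ½ :* ((x :- con ½) :+ (y :- con ½)))) refl x y ⟩
    - (½ * ((x - ½) + (y - ½)))       ∎
    where
    x = a (m ∸ k)
    y = a (m ∸ l)
  centred-initial : ∀ j → j ℕ.< l → ∣ b j ∣ ≤ 1ℚ
  centred-initial j j<l = ≤-trans (≤-reflexive ∣bj∣≡½) (≤ᵇ⇒≤ _)
    where
    σ : ℚ
    σ = negOnePow (suc (j ℕ./ k))
    ½[1+σ]-½≡σ½ : ½ * (1ℚ + σ) - ½ ≡ σ * ½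
    ½[1+σ]-½≡σ½ = solve 1 (λ σ → con ½ :* (con 1ℚ :+ σ) :- con ½ := σ :* con ½) refl σ
    ∣bj∣≡½ : ∣ b j ∣ ≡ ½
    ∣bj∣≡½ = begin
      ∣ a j - ½ ∣              ≡⟨ cong (λ x → ∣ x - ½ ∣) (initial j j<l) ⟩
      ∣ ½ * (1ℚ + σ) - ½ ∣     ≡⟨ cong ∣_∣ ½[1+σ]-½≡σ½ ⟩
      ∣ σ * ½ ∣                ≡⟨ ∣negOnePow*p∣≡∣p∣ (suc (j ℕ./ k)) ½ ⟩
      ½                        ∎
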